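{- Let $M\subset\mathbb{N}$ be a finite non-empty set. (a) If the graph $(M,E(M))$ is connected, then for every prime $p$, property $(S_p)$ implies property $(T_p)$. (b) Suppose $M$ is compatible with some tuple $(\succ_p)_{p\in P}$ of excellent orders (for a finite set $P$ of primes containing $\mathcal{P}(M)$). Then the graph $(M,E(M))$ is connected, $M$ satisfies $(S_p)$ for every prime $p$, and $M$ satisfies condition (I).
   Context: $\mathbb{N}=\{1,2,3,\dots\}$, $\mathbb{N}_0=\mathbb{N}\cup\{0\}$, $\mathbb{Z}_{[a,b]}=\mathbb{Z}\cap[a,b]$. For a prime $p$ and $m\in\mathbb{N}$, $v_p(m)$ is the exponent of $p$ in $m$ and $\pi_p(m):=m\,p^{ -v_p(m)}$. Graph of a finite set $M\subset\mathbb{N}$: the directed graph $(M,E(M))$ has an edge from $m_1\in M$ to $m_2\in M$ if $m_1/m_2=p^k$ for some prime $p$ and $k\ge1$ (a $p$-edge); $E_p(M)$ is the set of $p$-edges. The components of $(M,E(M)\setminus E_p(M))$ are the $p$-planes; a $p$-plane is highest if no $p$-edge ends at one of its vertices; a $p$-edge from $m_1$ to $m_2$ is highest if no $p$-edge ends at $m_1$. $(T_p)$: $(M,E(M))$ has only one highest $p$-plane. $(S_p)$: the graph $(M,E(M)\setminus\{\text{highest }p\text{ -edges}\})$ has only 1 or 2 connected components. Condition (I): $(M,E(M))$ is connected, satisfies $(S_2)$, and satisfies $(T_p)$ for all primes $p\ge3$. Connectedness refers to the underlying undirected graph. Excellent order: for $s\in\mathbb{N}_0$ and a subset $S\subset\mathbb{Z}_{[1,s]}$,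 the excellent order $\succ$ on $\mathbb{Z}_{[0,s]}$ (with $s(\succ)=s$, $S(\succ)=S$) is the strict total order which agrees with the usual $>$ on $S\cup\{0\}$, agrees with the usual $<$ on $\mathbb{Z}_{[0,s]}\setminus S$, and satisfies $k\succ 0\succ l$ for $k\in S$, $l\in\mathbb{Z}_{[1,s]}\setminus S$ (so $S=\{k\mid k\succ0\}$). For a finite set $P$ of primes and a tuple $(\succ_p)_{p\in P}$ of excellent orders, $V((\succ_p)_{p\in P}):=\{\prod_{p\in P}p^{k_p}\mid k_p\in\mathbb{Z}_{[0,s(\succ_p)]}\}$. A set $K\subset\mathbb{N}_0$ is subset compatible with an excellent order $\succ$ on $\mathbb{Z}_{[0,s]}$ if either $K=\mathbb{Z}_{[0,s]}$ or there is $k_K\in\mathbb{Z}_{[0,s]}$ with $K=\{k\in\mathbb{Z}_{[0,s]}\mid k\succ k_K\}$. For finite nonempty $M\subset\mathbb{N}$: $\mathcal{P}(M)$ is the set of primes dividing some element of $M$; for a prime $p$ and $m_0\in\pi_p(M)$, $K_{M,p,m_0}\subset\mathbb{N}_0$ is defined by $\pi_p^{ -1}(m_0)\cap M=\{m_0p^k\mid k\in K_{M,p,m_0}\}$. $M$ is compatible with $(\succ_p)_{p\in P}$ (where $P\supseteq\mathcal{P}(M)$ is finite) if $M\subset V((\succ_p)_{p\in P})$ and for every $p\in\mathcal{P}(M)$ and every $m_0\in\pi_p(M)$ the set $K_{M,p,m_0}$ is subset compatible with $\succ_p$. -}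

module Defs where

open import Data.Nat using (ℕ; zero; suc; _+_; _*_; _^_; _≤_; _<_; _≥_; NonZero)
open import Data.Nat.Divisibility using (_∣_; _∣?_; quotient)
open import Data.Nat.Primality using (Prime)
open import Data.List using (List; []; _∷_; map)
open import Data.Nat.ListAction using (product)
open import Data.List.Membership.Propositional using (_∈_; _∉_)
open import Data.List.Relation.Unary.All using (All)
open import Data.List.Relation.Unary.Unique.Propositional using (Unique)
open import Data.Product using (Σ; ∃; ∃-syntax; _×_; _,_)
open import Data.Sum using (_⊎_)
open import Relation.Nullary using (¬_; yes; no)
open import Relation.Binary.PropositionalEquality using (_≡_; _≢_)
open import Function.Bundles using (_⇔_)

-- Finite sets M ⊂ ℕ = {1,2,...} are represented by lists (membership
-- is list membership; duplicates are irrelevant).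

-- p-adic valuation and π_p, by recursion with fuel (fuel m suffices
-- for m ≥ 1 and p ≥ 2).

stripF : ℕ → ℕ → ℕ → ℕ
stripF zero    p m = m
stripF (suc f) p zero = zero
stripF (suc f) p (suc m) with p ∣? suc m
... | yes d = stripF f p (quotient d)
... | no  _ = suc m

valF : ℕ → ℕ → ℕ → ℕ
valF zero    p m = zero
valF (suc f) p zero = zero
valF (suc f) p (suc m) with p ∣? suc m
... | yes d = suc (valF f p (quotient d))
... | no  _ = zero

v : ℕ → ℕ → ℕ
v p m = valF m p m

-- π_p(m) = m p^{-v_p(m)}
π : ℕ → ℕ → ℕ
π p m = stripF m p m

PEdge : List ℕ → ℕ → ℕ → ℕ → Set
PEdge M p m₁ m₂ = m₁ ∈ M × m₂ ∈ M × Σ ℕ (λ k → k ≥ 1 × m₁ ≡ m₂ * p ^ k)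

Edge : List ℕ → ℕ → ℕ → Set
Edge M m₁ m₂ = Σ ℕ (λ q → Prime q × PEdge M q m₁ m₂)

EdgeNotP : List ℕ → ℕ → ℕ → ℕ → Set
EdgeNotP M p m₁ m₂ = Σ ℕ (λ q → Prime q × q ≢ p × PEdge M q m₁ m₂)

PEdgeInto : List ℕ → ℕ → ℕ → Set
PEdgeInto M p m = Σ ℕ (λ m' → PEdge M p m' m)

HighestPEdge : List ℕ → ℕ → ℕ → ℕ → Set
HighestPEdge M p m₁ m₂ = PEdge M p m₁ m₂ × ¬ PEdgeInto M p m₁

EdgeNotHighestP : List ℕ → ℕ → ℕ → ℕ → Set
EdgeNotHighestP M p m₁ m₂ =
  Σ ℕ (λ q → Prime q × PEdge M q m₁ m₂ × ¬ (q ≡ p × ¬ PEdgeInto M p m₁))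

data Path (R : ℕ → ℕ → Set) : ℕ → ℕ → Set where
  here : ∀ {a} → Path R a a
  fwd  : ∀ {a b c} → R a b → Path R b c → Path R a c
  bwd  : ∀ {a b c} → R b a → Path R b c → Path R a c

Connected : List ℕ → Set
Connected M = ∀ a b → a ∈ M → b ∈ M → Path (Edge M) a b

SamePPlane : List ℕ → ℕ → ℕ → ℕ → Set
SamePPlane M p m m' = Path (EdgeNotP M p) m m'

InHighestPPlane : List ℕ → ℕ → ℕ → Set
InHighestPPlane M p m =
  m ∈ M × (∀ m' → m' ∈ M → SamePPlane M p m m' → ¬ PEdgeInto M p m')

T : List ℕ → ℕ → Set
T M p = (Σ ℕ (λ m → InHighestPPlane M p m))
      × (∀ m m' → InHighestPPlane M p m → InHighestPPlane M p m' →
                  SamePPlane M p m m')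

-- (S_p): (M, E(M) ∖ {highest p-edges}) has only 1 or 2 connected
-- components, i.e. (M being nonempty) there are a, b ∈ M such that
-- every vertex is connected to a or to b.
S : List ℕ → ℕ → Set
S M p = Σ ℕ (λ a → Σ ℕ (λ b → a ∈ M × b ∈ M ×
          (∀ m → m ∈ M →
             Path (EdgeNotHighestP M p) m a ⊎ Path (EdgeNotHighestP M p) m b)))

CondI : List ℕ → Set
CondI M = Connected M × S M 2 × (∀ p → Prime p → p ≥ 3 → T M p)

-- an excellent order is given by s and S ⊂ ℤ_[1,s] (S as a list)
record ExcellentOrder : Set where
  field
    s     : ℕ
    Sset  : List ℕ
    S⊆    : All (λ k → 1 ≤ k × k ≤ s) Sset
open ExcellentOrder public

Up : ExcellentOrder → ℕ → Set
Up o k = k ≡ 0 ⊎ k ∈ Sset o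

Down : ExcellentOrder → ℕ → Set
Down o k = 1 ≤ k × k ∉ Sset o

data _⊢_≻_ (o : ExcellentOrder) : ℕ → ℕ → Set where
  up-up     : ∀ {k l} → k ≤ s o → Up o k → Up o l → l < k → o ⊢ k ≻ l
  down-down : ∀ {k l} → l ≤ s o → Down o k → Down o l → k < l → o ⊢ k ≻ l
  up-down   : ∀ {k l} → k ≤ s o → l ≤ s o → Up o k → Down o l → o ⊢ k ≻ l

-- V((≻_p)_{p∈P}); the tuple is given by a function ord on primes,
-- of which only the values at p ∈ P are used.
InV : List ℕ → (ℕ → ExcellentOrder) → ℕ → Set
InV P ord n = Σ (ℕ → ℕ) (λ k →
  All (λ p → k p ≤ s (ord p)) P × n ≡ product (map (λ p → p ^ k p) P))

SubsetCompatible : ExcellentOrder → (ℕ → Set) → Set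
SubsetCompatible o K =
  (∀ k → K k ⇔ k ≤ s o)
  ⊎ Σ ℕ (λ kK → kK ≤ s o × (∀ k → K k ⇔ (k ≤ s o × o ⊢ k ≻ kK)))

InPM : List ℕ → ℕ → Set
InPM M p = Prime p × Σ ℕ (λ m → m ∈ M × p ∣ m)

InπM : List ℕ → ℕ → ℕ → Set
InπM M p m₀ = Σ ℕ (λ m → m ∈ M × π p m ≡ m₀)

K : List ℕ → ℕ → ℕ → ℕ → Set
K M p m₀ k = m₀ * p ^ k ∈ M

Compatible : List ℕ → List ℕ → (ℕ → ExcellentOrder) → Set
Compatible M P ord =
  (∀ m → m ∈ M → InV P ord m)
  × (∀ p → InPM M p → ∀ m₀ → InπM M p m₀ →
       SubsetCompatible (ord p) (K M p m₀))

{-# OPTIONS --safe #-}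
-- Part (a): v_p is constant on p-planes and drops strictly along each p-edge, so a vertex of
-- maximal v_p lies in a highest p-plane.  A path avoiding highest p-edges cannot leave a
-- highest plane, so every highest plane contains one of the (at most two) representatives
-- given by (S_p).  If two different highest planes occurred, all of M would lie in highest
-- planes, so M would have no p-edges and connectedness would join the two inside one plane.
--
-- Part (b): write m ∈ M as ∏_{q∈P} q^{k_q}.  Subset compatibility says that raising the
-- q-exponent to the ≻_q-maximum stays inside M, along a single q-edge.  Doing this for every
-- q joins all of M to one centre; doing it for every q ≠ p joins m, avoiding p-edges, to the
-- "level" with the same p-exponent.  A level strictly between the extreme ones is entered by
-- a p-edge from the top level, so its p-edge down to the bottom level is not highest: at most
-- two components remain.
module Submission where

open import Defs
open import Data.Nat
open import Data.Nat.Divisibility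
open import Data.Nat.ListAction using (product)
open import Data.Nat.Primality
open import Data.Nat.Properties
open import Algebra.Properties.CommutativeSemigroup *-commutativeSemigroup using (xy∙z≈xz∙y)
open import Data.List using (List; []; _∷_; map; filter)
open import Data.List.Extrema.Nat
  using (max; argmax; argmin; argmax-sel; argmin-sel; max≤v⁺; xs≤max;
         f[⊥]≤f[argmax]; f[xs]≤f[argmax]; f[argmin]≤f[⊤]; f[argmin]≤f[xs])
open import Data.List.Membership.DecPropositional _≟_ using (_∈?_)
open import Data.List.Membership.Propositional using (_∈_; _∉_; find; lose)
open import Data.List.Membership.Propositional.Properties using (∈-filter⁺; ∈-filter⁻)
open import Data.List.Relation.Unary.All as All using (All; []; _∷_)
open import Data.List.Relation.Unary.All.Properties using (¬Any⇒All¬)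
open import Data.List.Relation.Unary.AllPairs using (_∷_)
open import Data.List.Relation.Unary.Any using (here; there; any?)
open import Data.List.Relation.Unary.Unique.Propositional using (Unique)
open import Data.Product using (_×_; _,_; proj₁; proj₂)
open import Data.Sum using (_⊎_; inj₁; inj₂)
open import Function using (it; _∘_; id)
open import Function.Bundles using (Equivalence)
open import Relation.Binary.Definitions using (tri<; tri≈; tri>)
open import Relation.Binary.PropositionalEquality
open import Relation.Nullary using (¬_; ¬?; yes; no; contradiction)

*-^-suc : ∀ a p k → a * p ^ k * p ≡ a * p ^ suc k
*-^-suc a p k = trans (*-assoc a (p ^ k) p) (cong (a *_) (*-comm (p ^ k) p))

∣*^suc : ∀ {p} a k → p ∣ a * p ^ suc k
∣*^suc {p} a k = divides (a * p ^ k) (sym (*-^-suc a p k))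

∤*^⇒≡0 : ∀ {p a} k → ¬ p ∣ a * p ^ k → k ≡ 0
∤*^⇒≡0 zero    _ = refl
∤*^⇒≡0 {a = a} (suc k) p∤ = contradiction (∣*^suc a k) p∤

p∤1 : ∀ {p} → Prime p → ¬ p ∣ 1
p∤1 {p} pp p∣1 = <-irrefl (sym (∣1⇒≡1 p∣1)) (nonTrivial⇒n>1 p {{prime⇒nonTrivial pp}})

p∣q^n⇒p≡q : ∀ {p q} n → Prime p → Prime q → p ∣ q ^ n → p ≡ q
p∣q^n⇒p≡q zero pp pq p∣1 = contradiction p∣1 (p∤1 pp)
p∣q^n⇒p≡q {p} {q} (suc n) pp pq p∣q^[1+n] with euclidsLemma q (q ^ n) pp p∣q^[1+n]
... | inj₂ p∣q^n = p∣q^n⇒p≡q n pp pq p∣q^n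
... | inj₁ p∣q with prime⇒irreducible pq p∣q
...   | inj₂ p≡q = p≡q
...   | inj₁ p≡1 = contradiction (subst (_∣ 1) (sym p≡1) ∣-refl) (p∤1 pp)

p∤m*n : ∀ {p m n} → Prime p → ¬ p ∣ m → ¬ p ∣ n → ¬ p ∣ m * n
p∤m*n {m = m} {n} pp p∤m p∤n p∣mn with euclidsLemma m n pp p∣mn
... | inj₁ p∣m = p∤m p∣m
... | inj₂ p∣n = p∤n p∣n

p-adic-unique : ∀ {p a b} .{{_ : NonZero p}} → ¬ p ∣ a → ¬ p ∣ b →
                ∀ i j → a * p ^ i ≡ b * p ^ j → a ≡ b × i ≡ j
p-adic-unique {a = a} {b} _ _ zero zero eq = *-cancelʳ-≡ a b 1 eq , refl
p-adic-unique {a = a} {b} p∤a p∤b zero (suc j) eq =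
  contradiction (subst (_ ∣_) (sym (trans (sym (*-identityʳ a)) eq)) (∣*^suc b j)) p∤a
p-adic-unique {a = a} {b} p∤a p∤b (suc i) zero eq =
  contradiction (subst (_ ∣_) (trans eq (*-identityʳ b)) (∣*^suc a i)) p∤b
p-adic-unique {p} {a} {b} p∤a p∤b (suc i) (suc j) eq
  with p-adic-unique p∤a p∤b i j
         (*-cancelʳ-≡ (a * p ^ i) (b * p ^ j) p
           (trans (*-^-suc a p i) (trans eq (sym (*-^-suc b p j)))))
... | a≡b , i≡j = a≡b , cong suc i≡j

stripF-valF : ∀ f p m → m ≡ stripF f p m * p ^ valF f p m
stripF-valF zero    p m       = sym (*-identityʳ m)
stripF-valF (suc f) p zero    = refl
stripF-valF (suc f) p (suc m) with p ∣? suc m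
... | no  _  = sym (*-identityʳ (suc m))
... | yes p∣ = begin
  suc m          ≡⟨ m∣n⇒n≡quotient*m p∣ ⟩
  q * p          ≡⟨ cong (_* p) (stripF-valF f p q) ⟩
  r * p ^ e * p  ≡⟨ *-^-suc r p e ⟩
  r * p ^ suc e  ∎
  where
  open ≡-Reasoning
  q = quotient p∣
  r = stripF f p q
  e = valF f p q

-- Fuel f suffices to strip every m ≤ f, since each step divides by p ≥ 2.
p∤stripF : ∀ {p} .{{_ : NonTrivial p}} f m .{{_ : NonZero m}} → m ≤ f → ¬ p ∣ stripF f p m
p∤stripF zero    m       m≤0 = contradiction (n≤0⇒n≡0 m≤0) (≢-nonZero⁻¹ m)
p∤stripF (suc f) zero    _   = contradiction refl (≢-nonZero⁻¹ 0)
p∤stripF {p} (suc f) (suc m) m≤f with p ∣? suc m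
... | no  p∤m = p∤m
... | yes p∣m = p∤stripF f (quotient p∣m) {{quotient≢0 p∣m}}
                  (m<1+n⇒m≤n (<-≤-trans (quotient-< p∣m) m≤f))

m≡π*p^v : ∀ p m → m ≡ π p m * p ^ v p m
m≡π*p^v p m = stripF-valF m p m

p∤π : ∀ {p} .{{_ : NonTrivial p}} m .{{_ : NonZero m}} → ¬ p ∣ π p m
p∤π m = p∤stripF m m ≤-refl

π≢0 : ∀ p m .{{_ : NonZero m}} → NonZero (π p m)
π≢0 p m = ≢-nonZero λ π≡0 →
  ≢-nonZero⁻¹ m (trans (m≡π*p^v p m) (cong (_* p ^ v p m) π≡0))

π-v-factor : ∀ {p a} .{{_ : NonTrivial p}} .{{_ : NonZero a}} → ¬ p ∣ a →
             ∀ k → π p (a * p ^ k) ≡ a × v p (a * p ^ k) ≡ k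
π-v-factor {p} {a} p∤a k =
  p-adic-unique (p∤π m) p∤a (v p m) k (sym (m≡π*p^v p m))
  where
  instance
    _ = nonTrivial⇒nonZero p
    _ : NonZero (a * p ^ k)
    _ = m*n≢0 a (p ^ k) {{it}} {{m^n≢0 p k}}
  m = a * p ^ k

v-*-indivisible : ∀ {p} → Prime p → ∀ m c .{{_ : NonZero m}} .{{_ : NonZero c}} →
                  ¬ p ∣ c → v p (m * c) ≡ v p m
v-*-indivisible {p} pp m c p∤c = begin
  v p (m * c)            ≡⟨ cong (λ n → v p (n * c)) (m≡π*p^v p m) ⟩
  v p (a * p ^ e * c)    ≡⟨ cong (v p) (xy∙z≈xz∙y a (p ^ e) c) ⟩
  v p (a * c * p ^ e)    ≡⟨ proj₂ (π-v-factor (p∤m*n pp (p∤π m) p∤c) e) ⟩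
  e                      ∎
  where
  open ≡-Reasoning
  a = π p m
  e = v p m
  instance
    _ = prime⇒nonTrivial pp
    _ = m*n≢0 a c {{π≢0 p m}} {{it}}

v-*-^ : ∀ {p} .{{_ : NonTrivial p}} m .{{_ : NonZero m}} k → v p (m * p ^ k) ≡ v p m + k
v-*-^ {p} m k = begin
  v p (m * p ^ k)            ≡⟨ cong (λ n → v p (n * p ^ k)) (m≡π*p^v p m) ⟩
  v p (a * p ^ e * p ^ k)    ≡⟨ cong (v p) (*-assoc a (p ^ e) (p ^ k)) ⟩
  v p (a * (p ^ e * p ^ k))  ≡⟨ cong (λ n → v p (a * n)) (^-distribˡ-+-* p e k) ⟨
  v p (a * p ^ (e + k))      ≡⟨ proj₂ (π-v-factor {{it}} {{π≢0 p m}} (p∤π m) (e + k)) ⟩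
  e + k                      ∎
  where
  open ≡-Reasoning
  a = π p m
  e = v p m

∏ : List ℕ → (ℕ → ℕ) → ℕ
∏ P k = product (map (λ q → q ^ k q) P)

_[_≔_] : (ℕ → ℕ) → ℕ → ℕ → ℕ → ℕ
(k [ p ≔ j ]) r with r ≟ p
... | yes _ = j
... | no  _ = k r

[≔]-same : ∀ k p j → (k [ p ≔ j ]) p ≡ j
[≔]-same k p j with p ≟ p
... | yes _   = refl
... | no  p≢p = contradiction refl p≢p

[≔]-other : ∀ k {p} j {r} → r ≢ p → (k [ p ≔ j ]) r ≡ k r
[≔]-other k {p} j {r} r≢p with r ≟ p
... | yes r≡p = contradiction r≡p r≢p
... | no  _   = refl

[≔]-id : ∀ k {p j} → k p ≡ j → ∀ r → (k [ p ≔ j ]) r ≡ k r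
[≔]-id k {p} kp≡j r with r ≟ p
... | yes refl = sym kp≡j
... | no  _    = refl

∏-cong : ∀ P {f g} → (∀ {r} → r ∈ P → f r ≡ g r) → ∏ P f ≡ ∏ P g
∏-cong []      f≗g = refl
∏-cong (q ∷ P) f≗g =
  cong₂ (λ e n → q ^ e * n) (f≗g (here refl)) (∏-cong P (f≗g ∘ there))

∏≢0 : ∀ {P} → All Prime P → ∀ k → NonZero (∏ P k)
∏≢0 []                 k = _
∏≢0 {q ∷ P} (pq ∷ ps) k =
  m*n≢0 (q ^ k q) (∏ P k) {{m^n≢0 q (k q) {{prime⇒nonZero pq}}}} {{∏≢0 ps k}}

∏-update : ∀ {P p} → Unique P → p ∈ P →
           ∀ k j → ∏ P (k [ p ≔ j ]) ≡ ∏ P (k [ p ≔ 0 ]) * p ^ j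
∏-update {q ∷ P} (q∉P ∷ _) (here refl) k j = begin
  q ^ (k [ q ≔ j ]) q * ∏ P (k [ q ≔ j ])
    ≡⟨ cong₂ (λ e n → q ^ e * n) ([≔]-same k q j) rest ⟩
  q ^ j * A
    ≡⟨ *-comm (q ^ j) A ⟩
  A * q ^ j
    ≡⟨ cong (_* q ^ j) (*-identityˡ A) ⟨
  q ^ 0 * A * q ^ j
    ≡⟨ cong (λ e → q ^ e * A * q ^ j) ([≔]-same k q 0) ⟨
  q ^ (k [ q ≔ 0 ]) q * A * q ^ j
    ∎
  where
  open ≡-Reasoning
  A = ∏ P (k [ q ≔ 0 ])
  rest : ∏ P (k [ q ≔ j ]) ≡ A
  rest = ∏-cong P λ r∈P → let r≢q = λ r≡q → All.lookup q∉P r∈P (sym r≡q) in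
    trans ([≔]-other k j r≢q) (sym ([≔]-other k 0 r≢q))
∏-update {q ∷ P} {p} (q∉P ∷ u) (there p∈P) k j = begin
  q ^ (k [ p ≔ j ]) q * ∏ P (k [ p ≔ j ])
    ≡⟨ cong (q ^ (k [ p ≔ j ]) q *_) (∏-update u p∈P k j) ⟩
  q ^ (k [ p ≔ j ]) q * (A * p ^ j)
    ≡⟨ *-assoc (q ^ (k [ p ≔ j ]) q) A (p ^ j) ⟨
  q ^ (k [ p ≔ j ]) q * A * p ^ j
    ≡⟨ cong (λ e → q ^ e * A * p ^ j) exponent ⟩
  q ^ (k [ p ≔ 0 ]) q * A * p ^ j
    ∎
  where
  open ≡-Reasoning
  A = ∏ P (k [ p ≔ 0 ])
  q≢p = All.lookup q∉P p∈P
  exponent : (k [ p ≔ j ]) q ≡ (k [ p ≔ 0 ]) q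
  exponent = trans ([≔]-other k j q≢p) (sym ([≔]-other k 0 q≢p))

∏-split : ∀ {P p} → Unique P → p ∈ P → ∀ k → ∏ P k ≡ ∏ P (k [ p ≔ 0 ]) * p ^ k p
∏-split {P} {p} u p∈P k =
  trans (∏-cong P (λ {r} _ → sym ([≔]-id k refl r))) (∏-update u p∈P k (k p))

p∤∏ : ∀ {P p} → Prime p → All Prime P → ∀ k → ¬ p ∣ ∏ P (k [ p ≔ 0 ])
p∤∏ {[]}    pp []        k = p∤1 pp
p∤∏ {q ∷ P} {p} pp (pq ∷ ps) k = p∤m*n pp p∤q^e (p∤∏ pp ps k)
  where
  p∤q^e : ¬ p ∣ q ^ (k [ p ≔ 0 ]) q
  p∤q^e with q ≟ p
  ... | yes _   = p∤1 pp
  ... | no  q≢p = q≢p ∘ sym ∘ p∣q^n⇒p≡q (k q) pp pq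

π-v-∏ : ∀ {P p} → Unique P → All Prime P → p ∈ P →
        ∀ k → π p (∏ P k) ≡ ∏ P (k [ p ≔ 0 ]) × v p (∏ P k) ≡ k p
π-v-∏ {P} {p} u ps p∈P k =
  subst (λ n → π p n ≡ ∏ P (k [ p ≔ 0 ]) × v p n ≡ k p) (sym (∏-split u p∈P k))
    (π-v-factor {{prime⇒nonTrivial pp}} {{∏≢0 ps (k [ p ≔ 0 ])}} (p∤∏ pp ps k) (k p))
  where pp = All.lookup ps p∈P

infixr 5 _++ᵖ_

_++ᵖ_ : ∀ {R a b c} → Path R a b → Path R b c → Path R a c
here    ++ᵖ q = q
fwd r p ++ᵖ q = fwd r (p ++ᵖ q)
bwd r p ++ᵖ q = bwd r (p ++ᵖ q)

reverseᵖ : ∀ {R a b} → Path R a b → Path R b a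
reverseᵖ here      = here
reverseᵖ (fwd r p) = reverseᵖ p ++ᵖ bwd r here
reverseᵖ (bwd r p) = reverseᵖ p ++ᵖ fwd r here

pedge-^ : ∀ {M p a i j} → a * p ^ i ∈ M → a * p ^ j ∈ M → i < j →
          PEdge M p (a * p ^ j) (a * p ^ i)
pedge-^ {p = p} {a} {i} {j} ai∈M aj∈M i<j = aj∈M , ai∈M , j ∸ i , m<n⇒0<n∸m i<j , eq
  where
  open ≡-Reasoning
  eq : a * p ^ j ≡ a * p ^ i * p ^ (j ∸ i)
  eq = begin
    a * p ^ j                  ≡⟨ cong (λ e → a * p ^ e) (m+[n∸m]≡n (<⇒≤ i<j)) ⟨
    a * p ^ (i + (j ∸ i))      ≡⟨ cong (a *_) (^-distribˡ-+-* p i (j ∸ i)) ⟩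
    a * (p ^ i * p ^ (j ∸ i))  ≡⟨ *-assoc a (p ^ i) (p ^ (j ∸ i)) ⟨
    a * p ^ i * p ^ (j ∸ i)    ∎

^-path : ∀ {M p a} {R : ℕ → ℕ → Set} → (∀ {x y} → PEdge M p x y → R x y) →
         ∀ {i j} → a * p ^ i ∈ M → a * p ^ j ∈ M → Path R (a * p ^ i) (a * p ^ j)
^-path {p = p} {a} edge {i} {j} ai∈M aj∈M with <-cmp i j
... | tri< i<j _ _ = bwd (edge (pedge-^ {p = p} {a} ai∈M aj∈M i<j)) here
... | tri≈ _ refl _ = here
... | tri> _ _ j<i = fwd (edge (pedge-^ {p = p} {a} aj∈M ai∈M j<i)) here

top : ExcellentOrder → ℕ
top o = max 0 (Sset o)

top-up : ∀ o → Up o (top o)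
top-up o = argmax-sel id 0 (Sset o)

top≤s : ∀ o → top o ≤ s o
top≤s o = max≤v⁺ z≤n (All.map proj₂ (S⊆ o))

up⇒≤top : ∀ o {k} → Up o k → k ≤ top o
up⇒≤top o (inj₁ refl) = z≤n
up⇒≤top o (inj₂ k∈S)  = All.lookup (xs≤max 0 (Sset o)) k∈S

top-≻ : ∀ o {k l} → o ⊢ k ≻ l → o ⊢ top o ≻ l
top-≻ o (up-up _ up-k up-l l<k)    =
  up-up (top≤s o) (top-up o) up-l (<-≤-trans l<k (up⇒≤top o up-k))
top-≻ o (down-down l≤s _ down-l _) = up-down (top≤s o) l≤s (top-up o) down-l
top-≻ o (up-down _ l≤s _ down-l)   = up-down (top≤s o) l≤s (top-up o) down-l

top∈subsetCompatible : ∀ o {K k} → SubsetCompatible o K → K k → K (top o)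
top∈subsetCompatible o (inj₁ K⇔≤s) _ = Equivalence.from (K⇔≤s (top o)) (top≤s o)
top∈subsetCompatible o {k = k} (inj₂ (_ , _ , K⇔≻)) Kk =
  Equivalence.from (K⇔≻ (top o)) (top≤s o , top-≻ o (proj₂ (Equivalence.to (K⇔≻ k) Kk)))

module _ (f : ℕ → ℕ) (x : ℕ) (xs : List ℕ) where

  argmax∈ : argmax f x xs ∈ x ∷ xs
  argmax∈ with argmax-sel f x xs
  ... | inj₁ ≡x   = here ≡x
  ... | inj₂ ∈xs  = there ∈xs

  argmin∈ : argmin f x xs ∈ x ∷ xs
  argmin∈ with argmin-sel f x xs
  ... | inj₁ ≡x   = here ≡x
  ... | inj₂ ∈xs  = there ∈xs

  f≤f[argmax] : ∀ {m} → m ∈ x ∷ xs → f m ≤ f (argmax f x xs)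
  f≤f[argmax] (here refl) = f[⊥]≤f[argmax] {f = f} x xs
  f≤f[argmax] (there m∈)  = All.lookup (f[xs]≤f[argmax] x xs) m∈

  f[argmin]≤f : ∀ {m} → m ∈ x ∷ xs → f (argmin f x xs) ≤ f m
  f[argmin]≤f (here refl) = f[argmin]≤f[⊤] {f = f} x xs
  f[argmin]≤f (there m∈)  = All.lookup (f[argmin]≤f[xs] x xs) m∈

module _ {M : List ℕ} {p : ℕ} where

  -- No p-edge enters the highest plane and every p-edge leaving it is highest.
  nonHighestPath-stays : ∀ {h x y} → InHighestPPlane M p h → SamePPlane M p h x →
                         Path (EdgeNotHighestP M p) x y → SamePPlane M p h y
  nonHighestPath-stays hh hx here = hx
  nonHighestPath-stays hh hx (fwd (q , pq , e@(x∈M , _) , not-highest) rest) with q ≟ p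
  ... | yes q≡p = contradiction (q≡p , proj₂ hh _ x∈M hx) not-highest
  ... | no  q≢p = nonHighestPath-stays hh (hx ++ᵖ fwd (q , pq , q≢p , e) here) rest
  nonHighestPath-stays hh hx (bwd (q , pq , e@(_ , x∈M , _) , _) rest) with q ≟ p
  ... | yes refl = contradiction (_ , e) (proj₂ hh _ x∈M hx)
  ... | no  q≢p  = nonHighestPath-stays hh (hx ++ᵖ bwd (q , pq , q≢p , e) here) rest

  highestPPlane-closed : ∀ {h x} → InHighestPPlane M p h → SamePPlane M p h x → x ∈ M →
                         InHighestPPlane M p x
  highestPPlane-closed hh hx x∈M = x∈M , λ m m∈M xm → proj₂ hh m m∈M (hx ++ᵖ xm)

  noPEdge⇒samePPlane : (∀ m → m ∈ M → ¬ PEdgeInto M p m) →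
                       ∀ {x y} → Path (Edge M) x y → SamePPlane M p x y
  noPEdge⇒samePPlane none here = here
  noPEdge⇒samePPlane none (fwd (q , pq , e@(_ , y∈M , _)) rest) with q ≟ p
  ... | yes refl = contradiction (_ , e) (none _ y∈M)
  ... | no  q≢p  = fwd (q , pq , q≢p , e) (noPEdge⇒samePPlane none rest)
  noPEdge⇒samePPlane none (bwd (q , pq , e@(_ , x∈M , _)) rest) with q ≟ p
  ... | yes refl = contradiction (_ , e) (none _ x∈M)
  ... | no  q≢p  = bwd (q , pq , q≢p , e) (noPEdge⇒samePPlane none rest)

  connected∧S⇒highestPPlane-unique : Connected M → S M p →
    ∀ h h′ → InHighestPPlane M p h → InHighestPPlane M p h′ → SamePPlane M p h h′
  connected∧S⇒highestPPlane-unique conn (a , b , a∈M , b∈M , reach) h h′ hh hh′ =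
    join (plane-of hh) (plane-of hh′)
    where
    plane-of : ∀ {h} → InHighestPPlane M p h → SamePPlane M p h a ⊎ SamePPlane M p h b
    plane-of hh with reach _ (proj₁ hh)
    ... | inj₁ ha = inj₁ (nonHighestPath-stays hh here ha)
    ... | inj₂ hb = inj₂ (nonHighestPath-stays hh here hb)

    no-pedge : InHighestPPlane M p a → InHighestPPlane M p b →
               ∀ m → m ∈ M → ¬ PEdgeInto M p m
    no-pedge ha hb m m∈M with reach m m∈M
    ... | inj₁ ma = proj₂ ha m m∈M (nonHighestPath-stays ha here (reverseᵖ ma))
    ... | inj₂ mb = proj₂ hb m m∈M (nonHighestPath-stays hb here (reverseᵖ mb))

    across : InHighestPPlane M p a → InHighestPPlane M p b → SamePPlane M p h h′
    across ha hb = noPEdge⇒samePPlane (no-pedge ha hb) (conn h h′ (proj₁ hh) (proj₁ hh′))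

    join : SamePPlane M p h a ⊎ SamePPlane M p h b →
           SamePPlane M p h′ a ⊎ SamePPlane M p h′ b → SamePPlane M p h h′
    join (inj₁ ha) (inj₁ h′a) = ha ++ᵖ reverseᵖ h′a
    join (inj₂ hb) (inj₂ h′b) = hb ++ᵖ reverseᵖ h′b
    join (inj₁ ha) (inj₂ h′b) =
      across (highestPPlane-closed hh ha a∈M) (highestPPlane-closed hh′ h′b b∈M)
    join (inj₂ hb) (inj₁ h′a) =
      across (highestPPlane-closed hh′ h′a a∈M) (highestPPlane-closed hh hb b∈M)

module _ {M : List ℕ} (M≢0 : All NonZero M) {p : ℕ} (pp : Prime p) where

  private instance _ = prime⇒nonTrivial pp

  v-≡-along-EdgeNotP : ∀ {x y} → EdgeNotP M p x y → v p x ≡ v p y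
  v-≡-along-EdgeNotP {y = y} (q , pq , q≢p , _ , y∈M , k , _ , x≡y*q^k) =
    trans (cong (v p) x≡y*q^k)
      (v-*-indivisible pp y (q ^ k) {{All.lookup M≢0 y∈M}} {{m^n≢0 q k {{prime⇒nonZero pq}}}}
        (q≢p ∘ sym ∘ p∣q^n⇒p≡q k pp pq))

  samePPlane⇒v≡ : ∀ {x y} → SamePPlane M p x y → v p x ≡ v p y
  samePPlane⇒v≡ here         = refl
  samePPlane⇒v≡ (fwd e rest) = trans (v-≡-along-EdgeNotP e) (samePPlane⇒v≡ rest)
  samePPlane⇒v≡ (bwd e rest) = trans (sym (v-≡-along-EdgeNotP e)) (samePPlane⇒v≡ rest)

  v-<-along-PEdge : ∀ {x y} → PEdge M p x y → v p y < v p x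
  v-<-along-PEdge {y = y} (_ , y∈M , k , k≥1 , x≡y*p^k) =
    subst (v p y <_) (sym (trans (cong (v p) x≡y*p^k) (v-*-^ y {{All.lookup M≢0 y∈M}} k)))
      (m<m+n (v p y) k≥1)

  v-maximal⇒highestPPlane : ∀ {b} → b ∈ M → (∀ {m} → m ∈ M → v p m ≤ v p b) →
                            InHighestPPlane M p b
  v-maximal⇒highestPPlane b∈M maximal = b∈M , λ m _ bm (m′ , e@(m′∈M , _)) →
    <⇒≱ (subst (_< v p m′) (sym (samePPlane⇒v≡ bm)) (v-<-along-PEdge e)) (maximal m′∈M)

connected∧S⇒T : ∀ {x xs p} → All NonZero (x ∷ xs) → Prime p →
                Connected (x ∷ xs) → S (x ∷ xs) p → T (x ∷ xs) p
connected∧S⇒T {x} {xs} {p} M≢0 pp conn s =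
  (b , v-maximal⇒highestPPlane M≢0 pp (argmax∈ (v p) x xs) (f≤f[argmax] (v p) x xs)) ,
  connected∧S⇒highestPPlane-unique conn s
  where b = argmax (v p) x xs

update-path : ∀ {M P q} {R : ℕ → ℕ → Set} → Unique P → q ∈ P →
              (∀ {x y} → PEdge M q x y → R x y) →
              ∀ {k j} → ∏ P k ∈ M → ∏ P (k [ q ≔ j ]) ∈ M →
              Path R (∏ P k) (∏ P (k [ q ≔ j ]))
update-path {M} {P} {q} {R} P-unique q∈P edge {k} {j} k∈M kj∈M =
  subst₂ (Path R) (sym split) (sym updated)
    (^-path {a = ∏ P (k [ q ≔ 0 ])} edge {k q} {j}
      (subst (_∈ M) split k∈M) (subst (_∈ M) updated kj∈M))
  where
  split   = ∏-split P-unique q∈P k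
  updated = ∏-update P-unique q∈P k j

module Normalisation {M P : List ℕ} {ord : ℕ → ExcellentOrder}
  (P-unique : Unique P) (P-primes : All Prime P) (compat : Compatible M P ord) where

  -- Compatibility lets each exponent be raised to the ≻-maximum of its order, unless
  -- the prime divides no element of M, in which case the exponent is already 0.
  τ : ℕ → ℕ
  τ q with any? (q ∣?_) M
  ... | yes _ = top (ord q)
  ... | no  _ = 0

  update-τ∈ : ∀ {q k} → q ∈ P → ∏ P k ∈ M → ∏ P (k [ q ≔ τ q ]) ∈ M
  update-τ∈ {q} {k} q∈P k∈M with any? (q ∣?_) M
  ... | yes q∣M = subst (_∈ M) (sym (∏-update P-unique q∈P k (top (ord q))))
                    (top∈subsetCompatible (ord q) {k = k q} K-compatible (subst (_∈ M) split k∈M))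
    where
    A = ∏ P (k [ q ≔ 0 ])
    split = ∏-split P-unique q∈P k
    K-compatible : SubsetCompatible (ord q) (K M q A)
    K-compatible = proj₂ compat q (All.lookup P-primes q∈P , find q∣M) A
                     (∏ P k , k∈M , proj₁ (π-v-∏ P-unique P-primes q∈P k))
  ... | no  q∤M = subst (_∈ M) (∏-cong P (λ {r} _ → sym ([≔]-id k kq≡0 r))) k∈M
    where
    kq≡0 : k q ≡ 0
    kq≡0 = ∤*^⇒≡0 {a = ∏ P (k [ q ≔ 0 ])} (k q) λ q∣ →
      q∤M (lose k∈M (subst (q ∣_) (sym (∏-split P-unique q∈P k)) q∣))

  retarget : (ℕ → ℕ) → List ℕ → ℕ → ℕ
  retarget k []      = k
  retarget k (q ∷ Q) = retarget k Q [ q ≔ τ q ]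

  retarget-∈ : ∀ k {Q r} → r ∈ Q → retarget k Q r ≡ τ r
  retarget-∈ k {q ∷ Q} {r} r∈ with r ≟ q | r∈
  ... | yes refl | _          = refl
  ... | no  r≢q  | here r≡q   = contradiction r≡q r≢q
  ... | no  _    | there r∈Q  = retarget-∈ k r∈Q

  retarget-∉ : ∀ k {Q r} → r ∉ Q → retarget k Q r ≡ k r
  retarget-∉ k {[]}    _   = refl
  retarget-∉ k {q ∷ Q} {r} r∉ with r ≟ q
  ... | yes r≡q = contradiction (here r≡q) r∉
  ... | no  _   = retarget-∉ k (r∉ ∘ there)

  retarget-path : ∀ {R : ℕ → ℕ → Set} Q → (∀ {q} → q ∈ Q → q ∈ P) →
                  (∀ {q x y} → q ∈ Q → PEdge M q x y → R x y) →
                  ∀ {k} → ∏ P k ∈ M →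
                  ∏ P (retarget k Q) ∈ M × Path R (∏ P k) (∏ P (retarget k Q))
  retarget-path []      _   _    k∈M = k∈M , here
  retarget-path (q ∷ Q) Q⊆P edge k∈M
    with retarget-path Q (Q⊆P ∘ there) (λ q∈Q → edge (there q∈Q)) k∈M
  ... | k′∈M , path = k″∈M , path ++ᵖ update-path P-unique q∈P (edge (here refl)) k′∈M k″∈M
    where
    q∈P = Q⊆P (here refl)
    k″∈M = update-τ∈ q∈P k′∈M

  private
    P-edge : ∀ {q x y} → q ∈ P → PEdge M q x y → Edge M x y
    P-edge q∈P e = _ , All.lookup P-primes q∈P , e

  path-to-centre : ∀ {m} → m ∈ M → ∏ P τ ∈ M × Path (Edge M) m (∏ P τ)
  path-to-centre m∈M with proj₁ compat _ m∈M
  ... | k , _ , m≡∏k with retarget-path P id P-edge (subst (_∈ M) m≡∏k m∈M)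
  ...   | c∈M , path = subst (_∈ M) centred c∈M , subst₂ (Path (Edge M)) (sym m≡∏k) centred path
    where centred = ∏-cong P (retarget-∈ k)

  connected : Connected M
  connected a b a∈M b∈M =
    proj₂ (path-to-centre a∈M) ++ᵖ reverseᵖ (proj₂ (path-to-centre b∈M))

  module _ {p : ℕ} (p∈P : p ∈ P) where

    private
      G = EdgeNotHighestP M p
      ≢p? = ¬? ∘ (_≟ p)
      P∖p = filter ≢p? P

      P∖p-edge : ∀ {q x y} → q ∈ P∖p → PEdge M q x y → G x y
      P∖p-edge q∈ e with ∈-filter⁻ ≢p? {xs = P} q∈
      ... | q∈P , q≢p = _ , All.lookup P-primes q∈P , e , q≢p ∘ proj₁

    level : ℕ → ℕ
    level j = ∏ P (τ [ p ≔ j ])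

    level-pedge : ∀ {i j} → level i ∈ M → level j ∈ M → i < j → PEdge M p (level j) (level i)
    level-pedge {i} {j} i∈M j∈M i<j =
      subst₂ (PEdge M p) (sym (lvl j)) (sym (lvl i))
        (pedge-^ {p = p} {∏ P (τ [ p ≔ 0 ])} (subst (_∈ M) (lvl i) i∈M)
          (subst (_∈ M) (lvl j) j∈M) i<j)
      where lvl = ∏-update P-unique p∈P τ

    path-to-level : ∀ {m} → m ∈ M → level (v p m) ∈ M × Path G m (level (v p m))
    path-to-level {m} m∈M with proj₁ compat m m∈M
    ... | k , _ , m≡∏k
      with retarget-path P∖p (proj₁ ∘ ∈-filter⁻ ≢p?) P∖p-edge (subst (_∈ M) m≡∏k m∈M)
    ...   | l∈M , path = subst (_∈ M) levelled l∈M , subst₂ (Path G) (sym m≡∏k) levelled path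
      where
      vm≡kp : v p m ≡ k p
      vm≡kp = trans (cong (v p) m≡∏k) (proj₂ (π-v-∏ P-unique P-primes p∈P k))
      p∉P∖p : p ∉ P∖p
      p∉P∖p p∈ = proj₂ (∈-filter⁻ ≢p? {xs = P} p∈) refl
      pointwise : ∀ {r} → r ∈ P → retarget k P∖p r ≡ (τ [ p ≔ v p m ]) r
      pointwise {r} r∈P with r ≟ p
      ... | yes refl = trans (retarget-∉ k p∉P∖p) (sym vm≡kp)
      ... | no  r≢p  = retarget-∈ k {P∖p} (∈-filter⁺ ≢p? r∈P r≢p)
      levelled = ∏-cong P pointwise

    level∈ : ∀ {m} → m ∈ M → level (v p m) ∈ M
    level∈ = proj₁ ∘ path-to-level

    to-level : ∀ {m} → m ∈ M → Path G m (level (v p m))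
    to-level = proj₂ ∘ path-to-level

    same-v⇒path : ∀ {m n} → m ∈ M → n ∈ M → v p m ≡ v p n → Path G m n
    same-v⇒path {n = n} m∈M n∈M vm≡vn =
      to-level m∈M ++ᵖ subst (λ j → Path G (level j) n) (sym vm≡vn) (reverseᵖ (to-level n∈M))

    extremal⇒S : ∀ {b a} → b ∈ M → a ∈ M →
                 (∀ {m} → m ∈ M → v p m ≤ v p b) → (∀ {m} → m ∈ M → v p a ≤ v p m) → S M p
    extremal⇒S {b} {a} b∈M a∈M below-b above-a = b , a , b∈M , a∈M , reach
      where
      reach : ∀ m → m ∈ M → Path G m b ⊎ Path G m a
      reach m m∈M with v p m ≟ v p b | v p m ≟ v p a
      ... | yes vm≡vb | _         = inj₁ (same-v⇒path m∈M b∈M vm≡vb)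
      ... | no  _     | yes vm≡va = inj₂ (same-v⇒path m∈M a∈M vm≡va)
      ... | no  vm≢vb | no  vm≢va = inj₂ (to-level m∈M ++ᵖ fwd down (reverseᵖ (to-level a∈M)))
        where
        entered : PEdgeInto M p (level (v p m))
        entered = _ , level-pedge (level∈ m∈M) (level∈ b∈M) (≤∧≢⇒< (below-b m∈M) vm≢vb)
        down : G (level (v p m)) (level (v p a))
        down = p , All.lookup P-primes p∈P ,
               level-pedge (level∈ a∈M) (level∈ m∈M) (≤∧≢⇒< (above-a m∈M) (vm≢va ∘ sym)) ,
               λ (_ , not-entered) → not-entered entered

InV-∷ : ∀ {P ord p n} → p ∉ P → InV P ord n → InV (p ∷ P) ord n
InV-∷ {P} {ord} {p} p∉P (k , k≤s , n≡∏k) = k [ p ≔ 0 ] , (p-bound ∷ P-bounds) , n≡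
  where
  ≢p : ∀ {q} → q ∈ P → q ≢ p
  ≢p q∈P q≡p = p∉P (subst (_∈ P) q≡p q∈P)
  p-bound : (k [ p ≔ 0 ]) p ≤ s (ord p)
  p-bound = subst (_≤ s (ord p)) (sym ([≔]-same k p 0)) z≤n
  P-bounds : All (λ q → (k [ p ≔ 0 ]) q ≤ s (ord q)) P
  P-bounds = All.tabulate λ q∈P →
    subst (_≤ _) (sym ([≔]-other k 0 (≢p q∈P))) (All.lookup k≤s q∈P)
  open ≡-Reasoning
  n≡ : _ ≡ ∏ (p ∷ P) (k [ p ≔ 0 ])
  n≡ = begin
    _                                   ≡⟨ n≡∏k ⟩
    ∏ P k                               ≡⟨ ∏-cong P (λ q∈P → sym ([≔]-other k 0 (≢p q∈P))) ⟩
    ∏ P (k [ p ≔ 0 ])                   ≡⟨ *-identityˡ _ ⟨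
    p ^ 0 * ∏ P (k [ p ≔ 0 ])           ≡⟨ cong (λ e → p ^ e * ∏ P (k [ p ≔ 0 ])) ([≔]-same k p 0) ⟨
    ∏ (p ∷ P) (k [ p ≔ 0 ])             ∎

compatible-∷ : ∀ {M P ord p} → p ∉ P → Compatible M P ord → Compatible M (p ∷ P) ord
compatible-∷ {ord = ord} p∉P (in-V , K-compatible) =
  (λ m m∈M → InV-∷ {ord = ord} p∉P (in-V m m∈M)) , K-compatible

compatible∧∈⇒S : ∀ {x xs P ord p} → Unique P → All Prime P → Compatible (x ∷ xs) P ord →
                  p ∈ P → S (x ∷ xs) p
compatible∧∈⇒S {x} {xs} {p = p} P-unique P-primes compat p∈P =
  Normalisation.extremal⇒S P-unique P-primes compat p∈P (argmax∈ (v p) x xs) (argmin∈ (v p) x xs)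
    (f≤f[argmax] (v p) x xs) (f[argmin]≤f (v p) x xs)

compatible⇒S : ∀ {x xs P ord p} → Unique P → All Prime P → Compatible (x ∷ xs) P ord →
               Prime p → S (x ∷ xs) p
compatible⇒S {P = P} {p = p} P-unique P-primes compat pp with p ∈? P
... | yes p∈P = compatible∧∈⇒S P-unique P-primes compat p∈P
... | no  p∉P =
  compatible∧∈⇒S (¬Any⇒All¬ P p∉P ∷ P-unique) (pp ∷ P-primes) (compatible-∷ p∉P compat) (here refl)

lemma2p7 : (M : List ℕ) → M ≢ [] → All NonZero M →
    ((∀ p → Prime p → Connected M → S M p → T M p)
    × (∀ (P : List ℕ) (ord : ℕ → ExcellentOrder) →
         Unique P → All Prime P → (∀ p → InPM M p → p ∈ P) →
         Compatible M P ord →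
         Connected M × (∀ p → Prime p → S M p) × CondI M))
lemma2p7 []       M≢[] _   = contradiction refl M≢[]
lemma2p7 (x ∷ xs) _    M≢0 = (λ p pp → connected∧S⇒T M≢0 pp) , part-b
  where
  part-b : ∀ P ord → Unique P → All Prime P → (∀ p → InPM (x ∷ xs) p → p ∈ P) →
           Compatible (x ∷ xs) P ord →
           Connected (x ∷ xs) × (∀ p → Prime p → S (x ∷ xs) p) × CondI (x ∷ xs)
  part-b P ord P-unique P-primes _ compat = conn , S-all , conn , S-all 2 prime[2] , T-odd
    where
    conn = Normalisation.connected P-unique P-primes compat
    S-all : ∀ p → Prime p → S (x ∷ xs) p
    S-all p pp = compatible⇒S P-unique P-primes compat pp
    T-odd : ∀ p → Prime p → p ≥ 3 → T (x ∷ xs) p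
    T-odd p pp _ = connected∧S⇒T M≢0 pp conn (S-all p pp)
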